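{- Given a normalised Horn-$\mathcal{ALCHIQ}$ TBox $\mathcal{T}$, for each set of 2-types $F$ such that $\pi_1(t) = \pi_1(t')$ for all $t,t' \in F$, there exists a unique good successor configuration $\mathrm{succ}_{\mathcal{T}}(F)$.
   Context: A normalised Horn-$\mathcal{ALCHIQ}$ TBox consists of concept inclusions of the forms $A_0 \sqcap \dots \sqcap A_n \sqsubseteq B$, $A \sqsubseteq {\leq_1} r.B$, $A \sqsubseteq \forall r.B$, $A \sqsubseteq \exists r.B$ (with $A, A_i, B$ concept names, $\top$ or $\bot$, and $r$ a role, i.e. a role name $p$ or its inverse $p^-$) and role inclusions $r \sqsubseteq r'$. For a finite set $M=\{M_1,\dots,M_k\}$ of concept names, $\sqcap M$ denotes the conjunction $M_1 \sqcap \dots \sqcap M_k$; for a finite set $R$ of roles and $N$ of concept names, $\exists(\sqcap R).(\sqcap N)$ is interpreted as the set of elements $e$ for which some $e'$ satisfies $(e,e') \in r^{\mathcal{I}}$ for all $r\in R$ and $e' \in A^{\mathcal{I}}$ for all $A \in N$. A 2-type is a triple $t \in \mathcal{P}(N_C) \times \mathcal{P}(\text{roles}) \times \mathcal{P}(N_C)$, a 1½-type is a pair $u \in \mathcal{P}(\text{roles}) \times \mathcal{P}(N_C)$, and $\pi_i$ denotes the $i$-th projection. For a set $F$ of 2-types with equal first components, a good successor configuration $\mathrm{succ}_{\mathcal{T}}(F)$ is a set of 1½-types such that: (R1) if $M \subseteq \pi_1(t)$ for some $t\in F$, $\mathcal{T} \models \sqcap M \sqsubseteq \exists(\sqcap R).(\sqcap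 N)$ for some $N \subseteq N_C$, $R$ a set of roles, and for all $t \in F$, $R \not\subseteq \pi_2(t)$ or $N \not\subseteq \pi_3(t)$, then there is $u \in \mathrm{succ}_{\mathcal{T}}(F)$ with $R \subseteq \pi_1(u)$ and $N \subseteq \pi_2(u)$; (R2) for each $u \in \mathrm{succ}_{\mathcal{T}}(F)$ there is $M \subseteq \pi_1(t)$ for some $t\in F$ with $\mathcal{T} \models \sqcap M \sqsubseteq \exists(\sqcap \pi_1(u)).(\sqcap \pi_2(u))$; (R3) there do not exist two distinct $u,u' \in \mathrm{succ}_{\mathcal{T}}(F)$ with $\pi_1(u)\subseteq\pi_1(u')$ and $\pi_2(u)\subseteq\pi_2(u')$; (R4) for each $u \in \mathrm{succ}_{\mathcal{T}}(F)$ and all $t\in F$, $\pi_1(u)\not\subseteq\pi_2(t)$ or $\pi_2(u)\not\subseteq\pi_3(t)$. -}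

module Defs where

open import Level using (Level; suc; 0ℓ)
open import Data.Nat using (ℕ)
open import Data.Fin using (Fin)
open import Data.Fin.Subset using (Subset; _∈_; _⊆_; ⊥; ⊤)
open import Data.Product using (Σ; ∃; _×_; _,_; proj₁; proj₂)
open import Data.Sum using (_⊎_)
open import Data.List using (List)
open import Data.List.Relation.Unary.All using (All)
import Data.List.Membership.Propositional as LM
open import Relation.Binary.PropositionalEquality using (_≡_)
open import Relation.Nullary using (¬_)
import Data.Empty as E
import Data.Unit as U

module Sig {nC nR : ℕ} where

  ConceptName : Set
  ConceptName = Fin nC

  RoleName : Set
  RoleName = Fin nR

  data Role : Set where
    name : RoleName → Role
    inv  : RoleName → Role

  data BCon : Set where
    atom : ConceptName → BCon
    top  : BCon
    bot  : BCon

  data Axiom : Set where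
    -- A₀ ⊓ A₁ ⊓ … ⊓ Aₙ ⊑ B   (A₀ followed by the list A₁ … Aₙ)
    conjIncl   : BCon → List BCon → BCon → Axiom
    atMostOne  : BCon → Role → BCon → Axiom
    univIncl   : BCon → Role → BCon → Axiom
    existIncl  : BCon → Role → BCon → Axiom
    roleIncl   : Role → Role → Axiom

  TBox : Set
  TBox = List Axiom

  record Interp : Set₁ where
    field
      Δ     : Set
      elem  : Δ
      conc  : ConceptName → Δ → Set
      rname : RoleName → Δ → Δ → Set

  module _ (I : Interp) where
    open Interp I

    roleI : Role → Δ → Δ → Set
    roleI (name p) x y = rname p x y
    roleI (inv p)  x y = rname p y x

    bconI : BCon → Δ → Set
    bconI (atom A) x = conc A x
    bconI top      x = U.⊤
    bconI bot      x = E.⊥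

    satAx : Axiom → Set
    satAx (conjIncl A₀ As B) = ∀ x → bconI A₀ x → All (λ A → bconI A x) As → bconI B x
    satAx (atMostOne A r B)  = ∀ x y z → bconI A x → roleI r x y → bconI B y →
                                 roleI r x z → bconI B z → y ≡ z
    satAx (univIncl A r B)   = ∀ x y → bconI A x → roleI r x y → bconI B y
    satAx (existIncl A r B)  = ∀ x → bconI A x → Σ Δ (λ y → roleI r x y × bconI B y)
    satAx (roleIncl r s)     = ∀ x y → roleI r x y → roleI s x y

    models : TBox → Set
    models T = All satAx T

  -- Finite sets of roles: (set of role names p, set of role names p with p⁻ in the set).
  RoleSet : Set
  RoleSet = Subset nR × Subset nR

  _∈R_ : Role → RoleSet → Set
  name p ∈R R = p ∈ proj₁ R
  inv p  ∈R R = p ∈ proj₂ R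

  _⊆R_ : RoleSet → RoleSet → Set
  R ⊆R R' = ∀ r → r ∈R R → r ∈R R'

  Entails∃ : TBox → Subset nC → RoleSet → Subset nC → Set₁
  Entails∃ T M R N =
    (I : Interp) → models I T →
    (e : Interp.Δ I) → (∀ A → A ∈ M → Interp.conc I A e) →
    Σ (Interp.Δ I) λ e' → (∀ r → r ∈R R → roleI I r e e') × (∀ A → A ∈ N → Interp.conc I A e')

  TwoType : Set
  TwoType = Subset nC × RoleSet × Subset nC

  π₁ : TwoType → Subset nC
  π₁ (a , _ , _) = a
  π₂ : TwoType → RoleSet
  π₂ (_ , r , _) = r
  π₃ : TwoType → Subset nC
  π₃ (_ , _ , b) = b

  HalfType : Set
  HalfType = RoleSet × Subset nC

  R1 : TBox → List TwoType → List HalfType → Set₁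
  R1 T F S = ∀ (M : Subset nC) (R : RoleSet) (N : Subset nC) →
    Σ TwoType (λ t → t LM.∈ F × M ⊆ π₁ t) →
    Entails∃ T M R N →
    (∀ t → t LM.∈ F → ¬ (R ⊆R π₂ t) ⊎ ¬ (N ⊆ π₃ t)) →
    Σ HalfType λ u → u LM.∈ S × R ⊆R proj₁ u × N ⊆ proj₂ u

  R2 : TBox → List TwoType → List HalfType → Set₁
  R2 T F S = ∀ u → u LM.∈ S →
    Σ TwoType λ t → Σ (Subset nC) λ M → t LM.∈ F × M ⊆ π₁ t × Entails∃ T M (proj₁ u) (proj₂ u)

  R3 : List HalfType → Set
  R3 S = ∀ u u' → u LM.∈ S → u' LM.∈ S → ¬ (u ≡ u') →
    ¬ (proj₁ u ⊆R proj₁ u' × proj₂ u ⊆ proj₂ u')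

  R4 : List TwoType → List HalfType → Set
  R4 F S = ∀ u t → u LM.∈ S → t LM.∈ F → ¬ (proj₁ u ⊆R π₂ t) ⊎ ¬ (proj₂ u ⊆ π₃ t)

  GoodSucc : TBox → List TwoType → List HalfType → Set₁
  GoodSucc T F S = R1 T F S × R2 T F S × R3 S × R4 F S

{-# OPTIONS --safe #-}
module Submission where

-- By (R2) and (R4) every member u of a good configuration is required:
-- T ⊨ ⊓(π₁ t) ⊑ ∃(⊓π₁ u).(⊓π₂ u) for some t ∈ F, and u is realised by no t ∈ F. By (R1) and (R3)
-- the members are then exactly the ≼-maximal required 1½-types, so a good configuration is unique,
-- and it exists as soon as being required is decidable. Entailment is decided by saturating a
-- finite calculus of judgements K ⊑ B, K ⊑ ∃R∙N and K ⊑◇ N (some element satisfies N) between sets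
-- of concept names. The calculus is sound, and complete because, unless K ⊑ ⊥ is derived, the tree
-- whose children are the maximal derived successors not already provided by the parent node is a
-- model of T with a root in K.

open import Data.Bool using (Bool; true; false; T; _∨_; _∧_; if_then_else_)
import Data.Bool.Properties as Bool
open import Data.Bool.Properties using (T-∨; T-∧; T-irrelevant)
open import Data.Empty using (⊥-elim) renaming (⊥ to Empty)
open import Data.Fin using (Fin)
import Data.Fin.Properties as Fin
open import Data.Fin.Subset using (Subset; _∈_; _⊆_; _∪_; ⁅_⁆; inside; outside; ∣_∣) renaming (⊥ to ∅)
open import Data.Fin.Subset.Properties
  using ( _∈?_; _⊆?_; ∉⊥; x∈⁅x⁆; x∈⁅y⁆⇒x≡y; x∈p∪q⁻; x∈p∪q⁺; p⊆p∪q; q⊆p∪q; ⊆-refl; ⊆-trans; ⊆-antisym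
        ; p⊆q⇒∣p∣≤∣q∣; p⊂q⇒∣p∣<∣q∣; ∣p∣≤n)
open import Data.List using (List; []; _∷_; _++_; map; cartesianProduct; allFin; length; filter)
open import Data.List.Membership.Propositional using (find; lose) renaming (_∈_ to _∈ˡ_)
open import Data.List.Membership.Propositional.Properties
  using (∈-map⁺; ∈-++⁺ˡ; ∈-++⁺ʳ; ∈-cartesianProduct⁺; ∈-allFin; ∈-filter⁺; ∈-filter⁻)
open import Data.List.Relation.Unary.All using (All; all?) renaming (lookup to lookupᴬ)
import Data.List.Relation.Unary.All as All
open import Data.List.Relation.Unary.Any using (Any; here; there; any?)
open import Data.Nat using (ℕ; zero; suc; _≤_; _<_; _+_; _∸_; z≤n; s≤s)
open import Data.Nat.Properties
  using (≤-trans; <-irrefl; m≤n⇒m≤1+n; m≤m+n; +-suc; +-monoʳ-≤; +-mono-≤; +-mono-<-≤; +-mono-≤-<; ∸-monoʳ-<)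
open import Data.Nat.Induction using (<-wellFounded; Acc; acc)
open import Data.Product using (Σ; ∃; _×_; _,_; proj₁; proj₂; uncurry)
import Data.Product.Properties as ×
open import Data.Sum using (_⊎_; inj₁; inj₂; [_,_]′; swap)
open import Data.Unit using (⊤; tt)
open import Data.Vec using () renaming ([] to []ᵛ; _∷_ to _∷ᵛ_)
import Data.Vec.Properties as Vec
open import Function using (_∘_)
open import Function.Bundles using (_⇔_; mk⇔; Equivalence)
open import Relation.Binary.PropositionalEquality using (_≡_; _≢_; refl; sym; trans; cong; subst)
open import Relation.Nullary using (¬_; Dec; yes; no)
open import Relation.Nullary.Decidable
  using (decidable-stable; _×-dec_; _⊎-dec_; _→-dec_; ¬?; map′; ⌊_⌋; T?; toWitness; fromWitness)
open import Relation.Unary using (Decidable)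

open import Defs

Enumeration : Set → Set
Enumeration A = Σ (List A) λ xs → ∀ x → x ∈ˡ xs

module _ {A : Set} (enum : Enumeration A) where

  ∃? : ∀ {q} {Q : A → Set q} → Decidable Q → Dec (∃ Q)
  ∃? {Q = Q} Q? = map′ witness (λ (x , q) → lose (proj₂ enum x) q) (any? Q? (proj₁ enum))
    where
      witness : Any Q (proj₁ enum) → ∃ Q
      witness a = let (x , _ , q) = find a in x , q

decide-via : ∀ {a b} {A : Set a} {B : Set b} → Dec A → (A → B) → (B → A) → Dec B
decide-via a? to from = map′ to from a?

subsets : ∀ n → Enumeration (Subset n)
subsets zero = []ᵛ ∷ [] , λ { []ᵛ → here refl }
subsets (suc n) = map (inside ∷ᵛ_) xs ++ map (outside ∷ᵛ_) xs , complete
  where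
    xs = proj₁ (subsets n)
    complete : ∀ p → p ∈ˡ map (inside ∷ᵛ_) xs ++ map (outside ∷ᵛ_) xs
    complete (true ∷ᵛ p) = ∈-++⁺ˡ (∈-map⁺ (inside ∷ᵛ_) (proj₂ (subsets n) p))
    complete (false ∷ᵛ p) =
      ∈-++⁺ʳ (map (inside ∷ᵛ_) xs) (∈-map⁺ (outside ∷ᵛ_) (proj₂ (subsets n) p))

fins : ∀ {n} → Enumeration (Fin n)
fins {n} = allFin n , ∈-allFin

_×ᵉ_ : {A B : Set} → Enumeration A → Enumeration B → Enumeration (A × B)
(xs , ∈xs) ×ᵉ (ys , ∈ys) = cartesianProduct xs ys , λ (x , y) → ∈-cartesianProduct⁺ (∈xs x) (∈ys y)

module Counting {A : Set} where

  count : (A → Bool) → List A → ℕ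
  count f [] = 0
  count f (a ∷ as) = if f a then suc (count f as) else count f as

  _⊆ᵇ_ : (A → Bool) → (A → Bool) → Set
  f ⊆ᵇ g = ∀ a → T (f a) → T (g a)

  count-mono : ∀ {f g} → f ⊆ᵇ g → ∀ as → count f as ≤ count g as
  count-mono f⊆g [] = z≤n
  count-mono {f} {g} f⊆g (a ∷ as) with f a in fa | g a in ga
  ... | false | false = count-mono f⊆g as
  ... | false | true = m≤n⇒m≤1+n (count-mono f⊆g as)
  ... | true | false = ⊥-elim (subst T ga (f⊆g a (subst T (sym fa) tt)))
  ... | true | true = s≤s (count-mono f⊆g as)

  count-strict : ∀ {f g a as} → f ⊆ᵇ g → a ∈ˡ as → T (g a) → ¬ T (f a) → count f as < count g as
  count-strict {f} {g} {a} {_ ∷ as} f⊆g (here refl) ga ¬fa with f a | g a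
  ... | true | _ = ⊥-elim (¬fa tt)
  ... | false | true = s≤s (count-mono f⊆g as)
  count-strict {f} {g} {as = b ∷ bs} f⊆g (there a∈) ga ¬fa with f b in fb | g b in gb
  ... | false | false = count-strict f⊆g a∈ ga ¬fa
  ... | false | true = m≤n⇒m≤1+n (count-strict f⊆g a∈ ga ¬fa)
  ... | true | false = ⊥-elim (subst T gb (f⊆g b (subst T (sym fb) tt)))
  ... | true | true = s≤s (count-strict f⊆g a∈ ga ¬fa)

  count≤length : ∀ f as → count f as ≤ length as
  count≤length f [] = z≤n
  count≤length f (a ∷ as) with f a
  ... | true = s≤s (count≤length f as)
  ... | false = m≤n⇒m≤1+n (count≤length f as)

module Saturation {A : Set} (enum : Enumeration A) (step : (A → Bool) → A → Bool) where
  open Counting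

  stage : ℕ → A → Bool
  stage zero a = false
  stage (suc n) a = stage n a ∨ step (stage n) a

  Closed : (A → Bool) → Set
  Closed f = ∀ a → T (step f a) → T (f a)

  stage-inflationary : ∀ n → stage n ⊆ᵇ stage (suc n)
  stage-inflationary n a t = Equivalence.from T-∨ (inj₁ t)

  private
    xs = proj₁ enum

    search : ∀ n fuel → length xs ≤ fuel + count (stage n) xs → Σ ℕ (Closed ∘ stage)
    search n fuel bound with ∃? enum (λ a → T? (step (stage n) a) ×-dec ¬? (T? (stage n a)))
    ... | no none = n , λ a s → decidable-stable (T? (stage n a)) (λ ¬t → none (a , s , ¬t))
    ... | yes (a , s , ¬t) = continue fuel bound
      where
        grows : count (stage n) xs < count (stage (suc n)) xs
        grows = count-strict (stage-inflationary n) (proj₂ enum a) (Equivalence.from T-∨ (inj₂ s)) ¬t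

        continue : ∀ fuel → length xs ≤ fuel + count (stage n) xs → Σ ℕ (Closed ∘ stage)
        continue zero bound =
          ⊥-elim (<-irrefl refl (≤-trans (s≤s bound) (≤-trans grows (count≤length _ xs))))
        continue (suc fuel) bound =
          search (suc n) fuel (≤-trans bound
            (subst (_≤ fuel + count (stage (suc n)) xs) (+-suc fuel _) (+-monoʳ-≤ fuel grows)))

  closed-stage : Σ ℕ (Closed ∘ stage)
  closed-stage = search 0 (length xs) (m≤m+n (length xs) _)

module _ {nC nR : ℕ} where
  open Sig {nC} {nR}

  infix 25 _⁻ _⁻¹ᴿ
  infixl 6 _∪ᴿ_
  infix 4 _∈R?_ _⊆R?_ _≟ˢ_ _≟ᴿ_ _≟ʰ_ _≼_ _≼?_ _∈ᴮ_ _∈ᴮ?_ _≟ᴮ_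

  _⁻ : Role → Role
  name p ⁻ = inv p
  inv p ⁻ = name p

  ∅ᴿ : RoleSet
  ∅ᴿ = ∅ , ∅

  ⁅_⁆ᴿ : Role → RoleSet
  ⁅ name p ⁆ᴿ = ⁅ p ⁆ , ∅
  ⁅ inv p ⁆ᴿ = ∅ , ⁅ p ⁆

  _∪ᴿ_ : RoleSet → RoleSet → RoleSet
  (a , b) ∪ᴿ (c , d) = a ∪ c , b ∪ d

  _⁻¹ᴿ : RoleSet → RoleSet
  (a , b) ⁻¹ᴿ = b , a

  _∈R?_ : ∀ r R → Dec (r ∈R R)
  name p ∈R? R = p ∈? proj₁ R
  inv p ∈R? R = p ∈? proj₂ R

  ∉∅ᴿ : ∀ r → ¬ r ∈R ∅ᴿ
  ∉∅ᴿ (name p) = ∉⊥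
  ∉∅ᴿ (inv p) = ∉⊥

  r∈⁅r⁆ᴿ : ∀ r → r ∈R ⁅ r ⁆ᴿ
  r∈⁅r⁆ᴿ (name p) = x∈⁅x⁆ p
  r∈⁅r⁆ᴿ (inv p) = x∈⁅x⁆ p

  ∈⁅⁆ᴿ⇒≡ : ∀ r s → r ∈R ⁅ s ⁆ᴿ → r ≡ s
  ∈⁅⁆ᴿ⇒≡ (name p) (name q) h = cong name (x∈⁅y⁆⇒x≡y q h)
  ∈⁅⁆ᴿ⇒≡ (inv p) (inv q) h = cong inv (x∈⁅y⁆⇒x≡y q h)
  ∈⁅⁆ᴿ⇒≡ (name p) (inv q) h = ⊥-elim (∉⊥ h)
  ∈⁅⁆ᴿ⇒≡ (inv p) (name q) h = ⊥-elim (∉⊥ h)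

  ∈∪ᴿ⁻ : ∀ r R R' → r ∈R (R ∪ᴿ R') → r ∈R R ⊎ r ∈R R'
  ∈∪ᴿ⁻ (name p) R R' = x∈p∪q⁻ (proj₁ R) (proj₁ R')
  ∈∪ᴿ⁻ (inv p) R R' = x∈p∪q⁻ (proj₂ R) (proj₂ R')

  R⊆R∪ᴿR' : ∀ R R' → R ⊆R (R ∪ᴿ R')
  R⊆R∪ᴿR' R R' (name p) = p⊆p∪q (proj₁ R')
  R⊆R∪ᴿR' R R' (inv p) = p⊆p∪q (proj₂ R')

  R'⊆R∪ᴿR' : ∀ R R' → R' ⊆R (R ∪ᴿ R')
  R'⊆R∪ᴿR' R R' (name p) = q⊆p∪q (proj₁ R) (proj₁ R')
  R'⊆R∪ᴿR' R R' (inv p) = q⊆p∪q (proj₂ R) (proj₂ R')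

  ∈⁻¹ᴿ⇔∈⁻ : ∀ r R → r ∈R (R ⁻¹ᴿ) ⇔ r ⁻ ∈R R
  ∈⁻¹ᴿ⇔∈⁻ (name p) R = mk⇔ (λ h → h) (λ h → h)
  ∈⁻¹ᴿ⇔∈⁻ (inv p) R = mk⇔ (λ h → h) (λ h → h)

  ⊆R-refl : ∀ {R} → R ⊆R R
  ⊆R-refl r r∈ = r∈

  ⁻¹ᴿ-adjoint : ∀ {R R'} → R ⁻¹ᴿ ⊆R R' → R ⊆R R' ⁻¹ᴿ
  ⁻¹ᴿ-adjoint h (name p) = h (inv p)
  ⁻¹ᴿ-adjoint h (inv p) = h (name p)

  ⊆R-trans : ∀ {R R' R''} → R ⊆R R' → R' ⊆R R'' → R ⊆R R''
  ⊆R-trans h h' r = h' r ∘ h r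

  ⊆R⇔⊆×⊆ : ∀ R R' → R ⊆R R' ⇔ (proj₁ R ⊆ proj₁ R' × proj₂ R ⊆ proj₂ R')
  ⊆R⇔⊆×⊆ R R' = mk⇔ (λ h → (λ {p} → h (name p)) , (λ {p} → h (inv p)))
                      (λ { (h , h') (name p) → h ; (h , h') (inv p) → h' })

  _⊆R?_ : ∀ R R' → Dec (R ⊆R R')
  R ⊆R? R' = map′ (Equivalence.from (⊆R⇔⊆×⊆ R R')) (Equivalence.to (⊆R⇔⊆×⊆ R R'))
                  ((proj₁ R ⊆? proj₁ R') ×-dec (proj₂ R ⊆? proj₂ R'))

  _≟ˢ_ : ∀ {n} (p q : Subset n) → Dec (p ≡ q)
  _≟ˢ_ = Vec.≡-dec Bool._≟_

  _≟ᴿ_ : (R R' : RoleSet) → Dec (R ≡ R')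
  _≟ᴿ_ = ×.≡-dec _≟ˢ_ _≟ˢ_

  _≟ʰ_ : (u v : HalfType) → Dec (u ≡ v)
  _≟ʰ_ = ×.≡-dec _≟ᴿ_ _≟ˢ_

  roles : Enumeration Role
  roles = map name (allFin nR) ++ map inv (allFin nR) , λ where
    (name p) → ∈-++⁺ˡ (∈-map⁺ name (∈-allFin p))
    (inv p) → ∈-++⁺ʳ (map name (allFin nR)) (∈-map⁺ inv (∈-allFin p))

  roleSets : Enumeration RoleSet
  roleSets = subsets nR ×ᵉ subsets nR

  halfTypes : Enumeration HalfType
  halfTypes = roleSets ×ᵉ subsets nC

  _≼_ : HalfType → HalfType → Set
  u ≼ v = proj₁ u ⊆R proj₁ v × proj₂ u ⊆ proj₂ v

  _≼?_ : ∀ u v → Dec (u ≼ v)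
  u ≼? v = (proj₁ u ⊆R? proj₁ v) ×-dec (proj₂ u ⊆? proj₂ v)

  ≼-refl : ∀ {u} → u ≼ u
  ≼-refl = ⊆R-refl , ⊆-refl

  ≼-trans : ∀ {u v w} → u ≼ v → v ≼ w → u ≼ w
  ≼-trans (h₁ , h₂) (h₁' , h₂') = ⊆R-trans h₁ h₁' , ⊆-trans h₂ h₂'

  ⊆⇒≡⊎∣∣< : ∀ {n} {p q : Subset n} → p ⊆ q → p ≡ q ⊎ ∣ p ∣ < ∣ q ∣
  ⊆⇒≡⊎∣∣< {p = p} {q} p⊆q with Fin.any? (λ x → (x ∈? q) ×-dec ¬? (x ∈? p))
  ... | yes (x , x∈q , x∉p) = inj₂ (p⊂q⇒∣p∣<∣q∣ (p⊆q , x , x∈q , x∉p))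
  ... | no none =
    inj₁ (⊆-antisym p⊆q λ {x} x∈q → decidable-stable (x ∈? p) λ x∉p → none (x , x∈q , x∉p))

  size : HalfType → ℕ
  size ((a , b) , c) = ∣ a ∣ + ∣ b ∣ + ∣ c ∣

  size≤ : ∀ u → size u ≤ nR + nR + nC
  size≤ ((a , b) , c) = +-mono-≤ (+-mono-≤ (∣p∣≤n a) (∣p∣≤n b)) (∣p∣≤n c)

  size-strict : ∀ {u v} → u ≼ v → v ≢ u → size u < size v
  size-strict {(a , b) , c} {(a' , b') , c'} (R⊆R' , c⊆c') v≢u
    with a⊆a' , b⊆b' ← Equivalence.to (⊆R⇔⊆×⊆ (a , b) (a' , b')) R⊆R'
    with ⊆⇒≡⊎∣∣< a⊆a' | ⊆⇒≡⊎∣∣< b⊆b' | ⊆⇒≡⊎∣∣< c⊆c'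
  ... | inj₁ refl | inj₁ refl | inj₁ refl = ⊥-elim (v≢u refl)
  ... | inj₂ a< | _ | _ =
    +-mono-<-≤ (+-mono-<-≤ a< (p⊆q⇒∣p∣≤∣q∣ b⊆b')) (p⊆q⇒∣p∣≤∣q∣ c⊆c')
  ... | inj₁ _ | inj₂ b< | _ =
    +-mono-<-≤ (+-mono-≤-< (p⊆q⇒∣p∣≤∣q∣ a⊆a') b<) (p⊆q⇒∣p∣≤∣q∣ c⊆c')
  ... | inj₁ _ | inj₁ _ | inj₂ c< =
    +-mono-≤-< (+-mono-≤ (p⊆q⇒∣p∣≤∣q∣ a⊆a') (p⊆q⇒∣p∣≤∣q∣ b⊆b')) c<

  module Maximal {c} (C : HalfType → Set c) (C? : ∀ u → Dec (C u)) where

    Maximal : HalfType → Set c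
    Maximal u = C u × ¬ (∃ λ v → C v × u ≼ v × v ≢ u)

    maximal? : ∀ u → Dec (Maximal u)
    maximal? u = C? u ×-dec ¬? (∃? halfTypes λ v → C? v ×-dec u ≼? v ×-dec ¬? (v ≟ʰ u))

    maximal-unique : ∀ {u v} → Maximal u → C v → u ≼ v → v ≡ u
    maximal-unique {u} {v} (_ , unbeaten) Cv u≼v =
      decidable-stable (v ≟ʰ u) λ v≢u → unbeaten (v , Cv , u≼v , v≢u)

    maximal-above : ∀ {v} → C v → ∃ λ w → Maximal w × v ≼ w
    maximal-above {v} = climb v (<-wellFounded (nR + nR + nC ∸ size v))
      where
        climb : ∀ v → Acc _<_ (nR + nR + nC ∸ size v) → C v → ∃ λ w → Maximal w × v ≼ w
        climb v (acc rec) Cv with ∃? halfTypes (λ w → C? w ×-dec v ≼? w ×-dec ¬? (w ≟ʰ v))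
        ... | no unbeaten = v , (Cv , unbeaten) , ≼-refl
        ... | yes (w , Cw , v≼w , w≢v)
          with x , max , w≼x ← climb w (rec (∸-monoʳ-< (size-strict v≼w w≢v) (size≤ w))) Cw
             = x , max , ≼-trans v≼w w≼x

  conceptsOf : BCon → Subset nC
  conceptsOf (atom A) = ⁅ A ⁆
  conceptsOf top = ∅
  conceptsOf bot = ∅

  _∈ᴮ_ : BCon → Subset nC → Set
  atom A ∈ᴮ N = A ∈ N
  top ∈ᴮ N = ⊤
  bot ∈ᴮ N = Empty

  _∈ᴮ?_ : ∀ B N → Dec (B ∈ᴮ N)
  atom A ∈ᴮ? N = A ∈? N
  top ∈ᴮ? N = yes tt
  bot ∈ᴮ? N = no λ ()

  _≟ᴮ_ : (B B' : BCon) → Dec (B ≡ B')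
  atom A ≟ᴮ atom A' = map′ (cong atom) (λ { refl → refl }) (A Fin.≟ A')
  top ≟ᴮ top = yes refl
  bot ≟ᴮ bot = yes refl
  atom _ ≟ᴮ top = no λ ()
  atom _ ≟ᴮ bot = no λ ()
  top ≟ᴮ atom _ = no λ ()
  top ≟ᴮ bot = no λ ()
  bot ≟ᴮ atom _ = no λ ()
  bot ≟ᴮ top = no λ ()

  baseConcepts : Enumeration BCon
  baseConcepts = top ∷ bot ∷ map atom (allFin nC) , λ where
    (atom A) → there (there (∈-map⁺ atom (∈-allFin A)))
    top → here refl
    bot → there (here refl)

  record Shape (C : Set) : Set where
    field
      embed : C → Axiom
      match : ∀ ax → Dec (∃ λ c → embed c ≡ ax)
      embed-injective : ∀ {c c'} → embed c ≡ embed c' → c ≡ c'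

  occurs? : ∀ {C} (sh : Shape C) {Q : C → Set} → (∀ c → Dec (Q c)) →
            (𝒯 : TBox) → Dec (∃ λ c → Shape.embed sh c ∈ˡ 𝒯 × Q c)
  occurs? sh {Q} Q? 𝒯 = map′ located (λ (c , c∈ , q) → lose c∈ (c , refl , q)) (any? instance? 𝒯)
    where
      open Shape sh
      instance? : ∀ ax → Dec (∃ λ c → embed c ≡ ax × Q c)
      instance? ax with match ax
      ... | yes (c , refl) =
        map′ (λ q → c , refl , q) (λ (c' , eq , q) → subst Q (embed-injective eq) q) (Q? c)
      ... | no ¬match = no λ (c , eq , _) → ¬match (c , eq)
      located : Any (λ ax → ∃ λ c → embed c ≡ ax × Q c) 𝒯 → ∃ λ c → embed c ∈ˡ 𝒯 × Q c
      located a with find a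
      ... | _ , ax∈ , c , refl , q = c , ax∈ , q

  conjShape : Shape (BCon × List BCon × BCon)
  conjShape = record
    { embed = λ (A , As , B) → conjIncl A As B
    ; match = λ where
        (conjIncl A As B) → yes (_ , refl)
        (atMostOne _ _ _) → no λ ()
        (univIncl _ _ _) → no λ ()
        (existIncl _ _ _) → no λ ()
        (roleIncl _ _) → no λ ()
    ; embed-injective = λ { refl → refl }
    }

  atMostOneShape : Shape (BCon × Role × BCon)
  atMostOneShape = record
    { embed = λ (A , r , B) → atMostOne A r B
    ; match = λ where
        (atMostOne A r B) → yes (_ , refl)
        (conjIncl _ _ _) → no λ ()
        (univIncl _ _ _) → no λ ()
        (existIncl _ _ _) → no λ ()
        (roleIncl _ _) → no λ ()
    ; embed-injective = λ { refl → refl }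
    }

  univShape : Shape (BCon × Role × BCon)
  univShape = record
    { embed = λ (A , r , B) → univIncl A r B
    ; match = λ where
        (univIncl A r B) → yes (_ , refl)
        (conjIncl _ _ _) → no λ ()
        (atMostOne _ _ _) → no λ ()
        (existIncl _ _ _) → no λ ()
        (roleIncl _ _) → no λ ()
    ; embed-injective = λ { refl → refl }
    }

  existShape : Shape (BCon × Role × BCon)
  existShape = record
    { embed = λ (A , r , B) → existIncl A r B
    ; match = λ where
        (existIncl A r B) → yes (_ , refl)
        (conjIncl _ _ _) → no λ ()
        (atMostOne _ _ _) → no λ ()
        (univIncl _ _ _) → no λ ()
        (roleIncl _ _) → no λ ()
    ; embed-injective = λ { refl → refl }
    }

  roleInclShape : Shape (Role × Role)
  roleInclShape = record
    { embed = λ (r , s) → roleIncl r s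
    ; match = λ where
        (roleIncl r s) → yes (_ , refl)
        (conjIncl _ _ _) → no λ ()
        (atMostOne _ _ _) → no λ ()
        (univIncl _ _ _) → no λ ()
        (existIncl _ _ _) → no λ ()
    ; embed-injective = λ { refl → refl }
    }

  module _ (I : Interp) where
    open Interp I

    Holds : Subset nC → Δ → Set
    Holds N e = ∀ A → A ∈ N → conc A e

    Linked : RoleSet → Δ → Δ → Set
    Linked R e e' = ∀ r → r ∈R R → roleI I r e e'

    roleI-⁻ : ∀ r {e e'} → roleI I (r ⁻) e e' ⇔ roleI I r e' e
    roleI-⁻ (name p) = mk⇔ (λ h → h) (λ h → h)
    roleI-⁻ (inv p) = mk⇔ (λ h → h) (λ h → h)

    ∈ᴮ-sound : ∀ {B N e} → B ∈ᴮ N → Holds N e → bconI I B e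
    ∈ᴮ-sound {atom A} A∈N h = h A A∈N
    ∈ᴮ-sound {top} _ _ = tt

    conceptsOf-sound : ∀ B {e} → bconI I B e → Holds (conceptsOf B) e
    conceptsOf-sound (atom A) {e} Ae A' A'∈ = subst (λ X → conc X e) (sym (x∈⁅y⁆⇒x≡y A A'∈)) Ae
    conceptsOf-sound top _ A A∈ = ⊥-elim (∉⊥ A∈)

    conceptsOf-complete : ∀ B {e} → B ≢ bot → Holds (conceptsOf B) e → bconI I B e
    conceptsOf-complete (atom A) _ h = h A (x∈⁅x⁆ A)
    conceptsOf-complete top _ _ = tt
    conceptsOf-complete bot B≢⊥ _ = B≢⊥ refl

    Holds-∪ : ∀ {N N' e} → Holds N e → Holds N' e → Holds (N ∪ N') e
    Holds-∪ {N} {N'} h h' A A∈ = [ h A , h' A ]′ (x∈p∪q⁻ N N' A∈)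

    Linked-∪ᴿ : ∀ {R R' e e'} → Linked R e e' → Linked R' e e' → Linked (R ∪ᴿ R') e e'
    Linked-∪ᴿ {R} {R'} l l' r r∈ = [ l r , l' r ]′ (∈∪ᴿ⁻ r R R' r∈)

    Linked-⁅⁆ᴿ : ∀ r {e e'} → roleI I r e e' → Linked ⁅ r ⁆ᴿ e e'
    Linked-⁅⁆ᴿ r {e} {e'} re s s∈ = subst (λ t → roleI I t e e') (sym (∈⁅⁆ᴿ⇒≡ s r s∈)) re

    Linked-⁻¹ᴿ : ∀ {R e e'} → Linked R e' e → Linked (R ⁻¹ᴿ) e e'
    Linked-⁻¹ᴿ {R} l r r∈ =
      Equivalence.to (roleI-⁻ r) (l (r ⁻) (Equivalence.to (∈⁻¹ᴿ⇔∈⁻ r R) r∈))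

  entails∃-mono : ∀ {𝒯 M M' R R' N N'} → M ⊆ M' → R ⊆R R' → N ⊆ N' →
                  Entails∃ 𝒯 M R' N' → Entails∃ 𝒯 M' R N
  entails∃-mono M⊆ R⊆ N⊆ ent I m e h =
    let e' , l , h' = ent I m e (λ A → h A ∘ M⊆) in e' , (λ r → l r ∘ R⊆ r) , λ A → h' A ∘ N⊆

  module Calculus (𝒯 : TBox) where

    infix 4 _⊑_ _⊑∃_∙_ _⊑◇_

    data Judgement : Set where
      _⊑_ : Subset nC → BCon → Judgement
      _⊑∃_∙_ : Subset nC → RoleSet → Subset nC → Judgement
      _⊑◇_ : Subset nC → Subset nC → Judgement

    ⟦_⟧ : Judgement → Set₁
    ⟦ K ⊑ B ⟧ = (I : Interp) → models I 𝒯 → ∀ e → Holds I K e → bconI I B e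
    ⟦ K ⊑∃ R ∙ N ⟧ = Entails∃ 𝒯 K R N
    ⟦ K ⊑◇ N ⟧ = Entails∃ 𝒯 K ∅ᴿ N

    module Rules (P : Judgement → Set) where

      -- With A ⊑ ≤1 r.B, the S'-successor N' of an S-successor N of K is K itself.
      ReturnsVia : BCon × Role × BCon → Subset nC → RoleSet → Subset nC → RoleSet → Subset nC → Set
      ReturnsVia (A , r , B) K S N S' N' = r ⁻ ∈R S × P (N ⊑ A) × P (K ⊑ B) × r ∈R S' × B ∈ᴮ N'

      -- Computed indices are given as equations so that Step can be decided without index unification.
      data Step : Judgement → Set where
        present : ∀ {K B} → B ∈ᴮ K → Step (K ⊑ B)
        conj : ∀ {K A As B} → conjIncl A As B ∈ˡ 𝒯 →
          P (K ⊑ A) → All (λ A' → P (K ⊑ A')) As → Step (K ⊑ B)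
        univ-back : ∀ {K S N A r B} → univIncl A r B ∈ˡ 𝒯 →
          P (K ⊑∃ S ∙ N) → r ⁻ ∈R S → P (N ⊑ A) → Step (K ⊑ B)
        univ-clash : ∀ {K S N A r} → univIncl A r bot ∈ˡ 𝒯 →
          P (K ⊑∃ S ∙ N) → r ∈R S → P (K ⊑ A) → Step (K ⊑ bot)
        exist-clash : ∀ {K A r} → existIncl A r bot ∈ˡ 𝒯 → P (K ⊑ A) → Step (K ⊑ bot)
        succ-clash : ∀ {K S N} → P (K ⊑∃ S ∙ N) → P (N ⊑ bot) → Step (K ⊑ bot)
        return : ∀ {K S N S' N' A r B C} → atMostOne A r B ∈ˡ 𝒯 →
          P (K ⊑∃ S ∙ N) → P (N ⊑∃ S' ∙ N') → ReturnsVia (A , r , B) K S N S' N' →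
          C ∈ᴮ N' → Step (K ⊑ C)
        exist : ∀ {K S N A r B} → existIncl A r B ∈ˡ 𝒯 → P (K ⊑ A) →
          S ≡ ⁅ r ⁆ᴿ → N ≡ conceptsOf B → Step (K ⊑∃ S ∙ N)
        extend : ∀ {K S N N₀ A} → P (K ⊑∃ S ∙ N₀) → P (N₀ ⊑ atom A) →
          N ≡ N₀ ∪ ⁅ A ⁆ → Step (K ⊑∃ S ∙ N)
        univ-fwd : ∀ {K S N N₀ A r B} → univIncl A r B ∈ˡ 𝒯 →
          P (K ⊑∃ S ∙ N₀) → r ∈R S → P (K ⊑ A) → N ≡ N₀ ∪ conceptsOf B → Step (K ⊑∃ S ∙ N)
        role-incl : ∀ {K S S₀ N r s} → roleIncl r s ∈ˡ 𝒯 →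
          P (K ⊑∃ S₀ ∙ N) → r ∈R S₀ → S ≡ S₀ ∪ᴿ ⁅ s ⁆ᴿ → Step (K ⊑∃ S ∙ N)
        role-incl⁻ : ∀ {K S S₀ N r s} → roleIncl r s ∈ˡ 𝒯 →
          P (K ⊑∃ S₀ ∙ N) → r ⁻ ∈R S₀ → S ≡ S₀ ∪ᴿ ⁅ s ⁻ ⁆ᴿ → Step (K ⊑∃ S ∙ N)
        merge : ∀ {K S N S₁ N₁ S₂ N₂ A r B} → atMostOne A r B ∈ˡ 𝒯 →
          P (K ⊑∃ S₁ ∙ N₁) → P (K ⊑∃ S₂ ∙ N₂) → P (K ⊑ A) →
          r ∈R S₁ → r ∈R S₂ → B ∈ᴮ N₁ → B ∈ᴮ N₂ →
          S ≡ S₁ ∪ᴿ S₂ → N ≡ N₁ ∪ N₂ → Step (K ⊑∃ S ∙ N)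
        merge-return : ∀ {K S S₀ N S' N' A r B} → atMostOne A r B ∈ˡ 𝒯 →
          P (K ⊑∃ S₀ ∙ N) → P (N ⊑∃ S' ∙ N') → ReturnsVia (A , r , B) K S₀ N S' N' →
          S ≡ S₀ ∪ᴿ S' ⁻¹ᴿ → Step (K ⊑∃ S ∙ N)
        reach-here : ∀ {K N} → (∀ A → A ∈ N → P (K ⊑ atom A)) → Step (K ⊑◇ N)
        reach-succ : ∀ {K S N' N} → P (K ⊑∃ S ∙ N') → P (N' ⊑◇ N) → Step (K ⊑◇ N)

    module Soundness (P : Judgement → Set) (sound : ∀ {j} → P j → ⟦ j ⟧) where
      open Rules P

      return-is-origin : ∀ {K S N S' N' A r B} →
        atMostOne A r B ∈ˡ 𝒯 → ReturnsVia (A , r , B) K S N S' N' →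
        (I : Interp) → models I 𝒯 → ∀ {e e₁ e₂} → Holds I K e →
        Linked I S e e₁ → Holds I N e₁ → Linked I S' e₁ e₂ → Holds I N' e₂ → e ≡ e₂
      return-is-origin {r = r} mem (r⁻∈S , pA , pB , r∈S' , B∈N') I m {e} {e₁} {e₂} h l₁ h₁ l₂ h₂ =
        lookupᴬ m mem e₁ e e₂ (sound pA I m e₁ h₁) (Equivalence.to (roleI-⁻ I r) (l₁ (r ⁻) r⁻∈S))
          (sound pB I m e h) (l₂ r r∈S') (∈ᴮ-sound I B∈N' h₂)

      step-sound : ∀ {j} → Step j → ⟦ j ⟧
      step-sound (present B∈K) I m e h = ∈ᴮ-sound I B∈K h
      step-sound (conj mem p ps) I m e h =
        lookupᴬ m mem e (sound p I m e h) (All.map (λ p' → sound p' I m e h) ps)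
      step-sound (univ-back {r = r} mem pe r⁻∈S pA) I m e h =
        let e₁ , l , h₁ = sound pe I m e h
        in lookupᴬ m mem e₁ e (sound pA I m e₁ h₁) (Equivalence.to (roleI-⁻ I r) (l (r ⁻) r⁻∈S))
      step-sound (univ-clash {r = r} mem pe r∈S pA) I m e h =
        let e₁ , l , _ = sound pe I m e h in lookupᴬ m mem e e₁ (sound pA I m e h) (l r r∈S)
      step-sound (exist-clash mem pA) I m e h = proj₂ (proj₂ (lookupᴬ m mem e (sound pA I m e h)))
      step-sound (succ-clash pe p⊥) I m e h = let e₁ , _ , h₁ = sound pe I m e h in sound p⊥ I m e₁ h₁
      step-sound (return {C = C} mem pe pe' ret C∈N') I m e h =
        let e₁ , l₁ , h₁ = sound pe I m e h
            e₂ , l₂ , h₂ = sound pe' I m e₁ h₁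
        in subst (bconI I C) (sym (return-is-origin mem ret I m h l₁ h₁ l₂ h₂)) (∈ᴮ-sound I C∈N' h₂)
      step-sound (exist {r = r} {B} mem pA refl refl) I m e h =
        let e₁ , re₁ , Be₁ = lookupᴬ m mem e (sound pA I m e h)
        in e₁ , Linked-⁅⁆ᴿ I r re₁ , conceptsOf-sound I B Be₁
      step-sound (extend {A = A} pe pA refl) I m e h =
        let e₁ , l , h₁ = sound pe I m e h
        in e₁ , l , Holds-∪ I h₁ (conceptsOf-sound I (atom A) (sound pA I m e₁ h₁))
      step-sound (univ-fwd {r = r} {B} mem pe r∈S pA refl) I m e h =
        let e₁ , l , h₁ = sound pe I m e h
            Be₁ = lookupᴬ m mem e e₁ (sound pA I m e h) (l r r∈S)
        in e₁ , l , Holds-∪ I h₁ (conceptsOf-sound I B Be₁)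
      step-sound (role-incl {r = r} {s} mem pe r∈S refl) I m e h =
        let e₁ , l , h₁ = sound pe I m e h
        in e₁ , Linked-∪ᴿ I l (Linked-⁅⁆ᴿ I s (lookupᴬ m mem e e₁ (l r r∈S))) , h₁
      step-sound (role-incl⁻ {r = r} {s} mem pe r⁻∈S refl) I m e h =
        let e₁ , l , h₁ = sound pe I m e h
            se₁e = lookupᴬ m mem e₁ e (Equivalence.to (roleI-⁻ I r) (l (r ⁻) r⁻∈S))
        in e₁ , Linked-∪ᴿ I l (Linked-⁅⁆ᴿ I (s ⁻) (Equivalence.from (roleI-⁻ I s) se₁e)) , h₁
      step-sound (merge {r = r} mem pe pe' pA r∈S r∈S' B∈N B∈N' refl refl) I m e h
        with e₁ , l₁ , h₁ ← sound pe I m e h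
        with e₂ , l₂ , h₂ ← sound pe' I m e h
        with refl ← lookupᴬ m mem e e₁ e₂ (sound pA I m e h) (l₁ r r∈S) (∈ᴮ-sound I B∈N h₁)
                      (l₂ r r∈S') (∈ᴮ-sound I B∈N' h₂)
        = e₁ , Linked-∪ᴿ I l₁ l₂ , Holds-∪ I h₁ h₂
      step-sound (merge-return mem pe pe' ret refl) I m e h
        with e₁ , l₁ , h₁ ← sound pe I m e h
        with e₂ , l₂ , h₂ ← sound pe' I m e₁ h₁
        with refl ← return-is-origin mem ret I m h l₁ h₁ l₂ h₂
        = e₁ , Linked-∪ᴿ I l₁ (Linked-⁻¹ᴿ I l₂) , h₁
      step-sound (reach-here ps) I m e h =
        e , (λ r r∈ → ⊥-elim (∉∅ᴿ r r∈)) , λ A A∈ → sound (ps A A∈) I m e h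
      step-sound (reach-succ pe pr) I m e h =
        let e₁ , _ , h₁ = sound pe I m e h
            e₂ , _ , h₂ = sound pr I m e₁ h₁
        in e₂ , (λ r r∈ → ⊥-elim (∉∅ᴿ r r∈)) , h₂

    module Decision (P : Judgement → Set) (P? : ∀ j → Dec (P j)) where
      open Rules P

      returnsVia? : ∀ c K S N S' N' → Dec (ReturnsVia c K S N S' N')
      returnsVia? (A , r , B) K S N S' N' =
        r ⁻ ∈R? S ×-dec P? (N ⊑ A) ×-dec P? (K ⊑ B) ×-dec r ∈R? S' ×-dec B ∈ᴮ? N'

      step-⊑? : ∀ K B → Dec (Step (K ⊑ B))
      step-⊑? K B = decide-via
        ( B ∈ᴮ? K
        ⊎-dec occurs? conjShape (λ (A , As , B') →
                B' ≟ᴮ B ×-dec P? (K ⊑ A) ×-dec all? (λ A' → P? (K ⊑ A')) As) 𝒯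
        ⊎-dec ∃? halfTypes (λ (S , N) → P? (K ⊑∃ S ∙ N) ×-dec
                occurs? univShape (λ (A , r , B') → B' ≟ᴮ B ×-dec r ⁻ ∈R? S ×-dec P? (N ⊑ A)) 𝒯)
        ⊎-dec B ≟ᴮ bot ×-dec
                ( ∃? halfTypes (λ (S , N) → P? (K ⊑∃ S ∙ N) ×-dec
                    occurs? univShape (λ (A , r , B') → B' ≟ᴮ bot ×-dec r ∈R? S ×-dec P? (K ⊑ A)) 𝒯)
                ⊎-dec occurs? existShape (λ (A , r , B') → B' ≟ᴮ bot ×-dec P? (K ⊑ A)) 𝒯
                ⊎-dec ∃? halfTypes (λ (S , N) → P? (K ⊑∃ S ∙ N) ×-dec P? (N ⊑ bot)))
        ⊎-dec ∃? (halfTypes ×ᵉ halfTypes) (λ ((S , N) , (S' , N')) →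
                P? (K ⊑∃ S ∙ N) ×-dec P? (N ⊑∃ S' ∙ N') ×-dec B ∈ᴮ? N' ×-dec
                occurs? atMostOneShape (λ c → returnsVia? c K S N S' N') 𝒯))
        (λ where
          (inj₁ B∈K) → present B∈K
          (inj₂ (inj₁ (_ , mem , refl , p , ps))) → conj mem p ps
          (inj₂ (inj₂ (inj₁ (_ , pe , _ , mem , refl , r⁻∈S , pA)))) → univ-back mem pe r⁻∈S pA
          (inj₂ (inj₂ (inj₂ (inj₁ (refl , inj₁ (_ , pe , _ , mem , refl , r∈S , pA)))))) →
            univ-clash mem pe r∈S pA
          (inj₂ (inj₂ (inj₂ (inj₁ (refl , inj₂ (inj₁ (_ , mem , refl , pA))))))) → exist-clash mem pA
          (inj₂ (inj₂ (inj₂ (inj₁ (refl , inj₂ (inj₂ (_ , pe , p⊥))))))) → succ-clash pe p⊥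
          (inj₂ (inj₂ (inj₂ (inj₂ (_ , pe , pe' , C∈N' , _ , mem , ret))))) →
            return mem pe pe' ret C∈N')
        (λ where
          (present B∈K) → inj₁ B∈K
          (conj mem p ps) → inj₂ (inj₁ (_ , mem , refl , p , ps))
          (univ-back mem pe r⁻∈S pA) → inj₂ (inj₂ (inj₁ (_ , pe , _ , mem , refl , r⁻∈S , pA)))
          (univ-clash mem pe r∈S pA) →
            inj₂ (inj₂ (inj₂ (inj₁ (refl , inj₁ (_ , pe , _ , mem , refl , r∈S , pA)))))
          (exist-clash mem pA) → inj₂ (inj₂ (inj₂ (inj₁ (refl , inj₂ (inj₁ (_ , mem , refl , pA))))))
          (succ-clash pe p⊥) → inj₂ (inj₂ (inj₂ (inj₁ (refl , inj₂ (inj₂ (_ , pe , p⊥))))))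
          (return mem pe pe' ret C∈N') →
            inj₂ (inj₂ (inj₂ (inj₂ (_ , pe , pe' , C∈N' , _ , mem , ret)))))
      step-⊑∃? : ∀ K S N → Dec (Step (K ⊑∃ S ∙ N))
      step-⊑∃? K S N = decide-via
        ( occurs? existShape (λ (A , r , B) →
                P? (K ⊑ A) ×-dec S ≟ᴿ ⁅ r ⁆ᴿ ×-dec N ≟ˢ conceptsOf B) 𝒯
        ⊎-dec ∃? (subsets nC ×ᵉ fins) (λ (N₀ , A) →
                P? (K ⊑∃ S ∙ N₀) ×-dec P? (N₀ ⊑ atom A) ×-dec N ≟ˢ N₀ ∪ ⁅ A ⁆)
        ⊎-dec ∃? (subsets nC) (λ N₀ → P? (K ⊑∃ S ∙ N₀) ×-dec
                occurs? univShape (λ (A , r , B) →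
                  r ∈R? S ×-dec P? (K ⊑ A) ×-dec N ≟ˢ N₀ ∪ conceptsOf B) 𝒯)
        ⊎-dec ∃? roleSets (λ S₀ → P? (K ⊑∃ S₀ ∙ N) ×-dec
                occurs? roleInclShape (λ (r , s) → r ∈R? S₀ ×-dec S ≟ᴿ S₀ ∪ᴿ ⁅ s ⁆ᴿ) 𝒯)
        ⊎-dec ∃? roleSets (λ S₀ → P? (K ⊑∃ S₀ ∙ N) ×-dec
                occurs? roleInclShape (λ (r , s) → r ⁻ ∈R? S₀ ×-dec S ≟ᴿ S₀ ∪ᴿ ⁅ s ⁻ ⁆ᴿ) 𝒯)
        ⊎-dec ∃? (halfTypes ×ᵉ halfTypes) (λ ((S₁ , N₁) , (S₂ , N₂)) →
                P? (K ⊑∃ S₁ ∙ N₁) ×-dec P? (K ⊑∃ S₂ ∙ N₂) ×-dec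
                occurs? atMostOneShape (λ (A , r , B) →
                  P? (K ⊑ A) ×-dec r ∈R? S₁ ×-dec r ∈R? S₂ ×-dec B ∈ᴮ? N₁ ×-dec B ∈ᴮ? N₂) 𝒯
                ×-dec
                S ≟ᴿ S₁ ∪ᴿ S₂ ×-dec N ≟ˢ N₁ ∪ N₂)
        ⊎-dec ∃? (roleSets ×ᵉ halfTypes) (λ (S₀ , (S' , N')) →
                P? (K ⊑∃ S₀ ∙ N) ×-dec P? (N ⊑∃ S' ∙ N') ×-dec
                occurs? atMostOneShape (λ c → returnsVia? c K S₀ N S' N') 𝒯 ×-dec
                S ≟ᴿ S₀ ∪ᴿ S' ⁻¹ᴿ))
        (λ where
          (inj₁ (_ , mem , pA , S≡ , N≡)) → exist mem pA S≡ N≡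
          (inj₂ (inj₁ (_ , pe , pA , N≡))) → extend pe pA N≡
          (inj₂ (inj₂ (inj₁ (_ , pe , _ , mem , r∈S , pA , N≡)))) → univ-fwd mem pe r∈S pA N≡
          (inj₂ (inj₂ (inj₂ (inj₁ (_ , pe , _ , mem , r∈S₀ , S≡))))) → role-incl mem pe r∈S₀ S≡
          (inj₂ (inj₂ (inj₂ (inj₂ (inj₁ (_ , pe , _ , mem , r⁻∈S₀ , S≡)))))) →
            role-incl⁻ mem pe r⁻∈S₀ S≡
          (inj₂ (inj₂ (inj₂ (inj₂ (inj₂ (inj₁
              (_ , pe₁ , pe₂ , (_ , mem , pA , r∈S₁ , r∈S₂ , B∈N₁ , B∈N₂) , S≡ , N≡))))))) →
            merge mem pe₁ pe₂ pA r∈S₁ r∈S₂ B∈N₁ B∈N₂ S≡ N≡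
          (inj₂ (inj₂ (inj₂ (inj₂ (inj₂ (inj₂ (_ , pe , pe' , (_ , mem , ret) , S≡))))))) →
            merge-return mem pe pe' ret S≡)
        (λ where
          (exist mem pA S≡ N≡) → inj₁ (_ , mem , pA , S≡ , N≡)
          (extend pe pA N≡) → inj₂ (inj₁ (_ , pe , pA , N≡))
          (univ-fwd mem pe r∈S pA N≡) → inj₂ (inj₂ (inj₁ (_ , pe , _ , mem , r∈S , pA , N≡)))
          (role-incl mem pe r∈S₀ S≡) → inj₂ (inj₂ (inj₂ (inj₁ (_ , pe , _ , mem , r∈S₀ , S≡))))
          (role-incl⁻ mem pe r⁻∈S₀ S≡) →
            inj₂ (inj₂ (inj₂ (inj₂ (inj₁ (_ , pe , _ , mem , r⁻∈S₀ , S≡)))))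
          (merge mem pe₁ pe₂ pA r∈S₁ r∈S₂ B∈N₁ B∈N₂ S≡ N≡) →
            inj₂ (inj₂ (inj₂ (inj₂ (inj₂ (inj₁
              (_ , pe₁ , pe₂ , (_ , mem , pA , r∈S₁ , r∈S₂ , B∈N₁ , B∈N₂) , S≡ , N≡))))))
          (merge-return mem pe pe' ret S≡) →
            inj₂ (inj₂ (inj₂ (inj₂ (inj₂ (inj₂ (_ , pe , pe' , (_ , mem , ret) , S≡)))))))
      step-⊑◇? : ∀ K N → Dec (Step (K ⊑◇ N))
      step-⊑◇? K N = decide-via
        ( Fin.all? (λ A → A ∈? N →-dec P? (K ⊑ atom A))
        ⊎-dec ∃? halfTypes (λ (S , N') → P? (K ⊑∃ S ∙ N') ×-dec P? (N' ⊑◇ N)))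
        (λ where
          (inj₁ ps) → reach-here ps
          (inj₂ (_ , pe , pr)) → reach-succ pe pr)
        (λ where
          (reach-here ps) → inj₁ ps
          (reach-succ pe pr) → inj₂ (_ , pe , pr))

      step? : ∀ j → Dec (Step j)
      step? (K ⊑ B) = step-⊑? K B
      step? (K ⊑∃ S ∙ N) = step-⊑∃? K S N
      step? (K ⊑◇ N) = step-⊑◇? K N

    judgements : Enumeration Judgement
    judgements = map (uncurry _⊑_) xs₁ ++ map succ xs₂ ++ map (uncurry _⊑◇_) xs₃ , complete
      where
        xs₁ = proj₁ (subsets nC ×ᵉ baseConcepts)
        xs₂ = proj₁ ((subsets nC ×ᵉ roleSets) ×ᵉ subsets nC)
        xs₃ = proj₁ (subsets nC ×ᵉ subsets nC)
        succ : (Subset nC × RoleSet) × Subset nC → Judgement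
        succ ((K , S) , N) = K ⊑∃ S ∙ N
        complete : ∀ j → j ∈ˡ map (uncurry _⊑_) xs₁ ++ map succ xs₂ ++ map (uncurry _⊑◇_) xs₃
        complete (K ⊑ B) =
          ∈-++⁺ˡ (∈-map⁺ (uncurry _⊑_) (proj₂ (subsets nC ×ᵉ baseConcepts) (K , B)))
        complete (K ⊑∃ S ∙ N) = ∈-++⁺ʳ (map (uncurry _⊑_) xs₁)
          (∈-++⁺ˡ (∈-map⁺ succ (proj₂ ((subsets nC ×ᵉ roleSets) ×ᵉ subsets nC) ((K , S) , N))))
        complete (K ⊑◇ N) = ∈-++⁺ʳ (map (uncurry _⊑_) xs₁)
          (∈-++⁺ʳ (map succ xs₂) (∈-map⁺ (uncurry _⊑◇_) (proj₂ (subsets nC ×ᵉ subsets nC) (K , N))))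

    open Saturation judgements (λ s j → ⌊ Decision.step? (T ∘ s) (T? ∘ s) j ⌋)

    Derived : Judgement → Set
    Derived = T ∘ stage (proj₁ closed-stage)

    derived? : ∀ j → Dec (Derived j)
    derived? = T? ∘ stage (proj₁ closed-stage)

    derived-closed : ∀ {j} → Rules.Step Derived j → Derived j
    derived-closed {j} s = proj₂ closed-stage j (fromWitness s)

    stage-sound : ∀ n {j} → T (stage n j) → ⟦ j ⟧
    stage-sound (suc n) {j} t with Equivalence.to T-∨ t
    ... | inj₁ earlier = stage-sound n earlier
    ... | inj₂ step = Soundness.step-sound (T ∘ stage n) (stage-sound n) (toWitness step)

    derived-sound : ∀ {j} → Derived j → ⟦ j ⟧
    derived-sound = stage-sound (proj₁ closed-stage)

    module CanonicalModel (K₀ : Subset nC) (consistent : ¬ Derived (K₀ ⊑ bot)) where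
      open Rules Derived

      Path : Set
      Path = List HalfType

      ctx : Path → Subset nC
      ctx [] = K₀
      ctx (u ∷ _) = proj₂ u

      Label : Path → Fin nC → Set
      Label [] A = Derived (K₀ ⊑ atom A)
      Label (u ∷ _) A = A ∈ proj₂ u

      label? : ∀ x A → Dec (Label x A)
      label? [] A = derived? (K₀ ⊑ atom A)
      label? (u ∷ _) A = A ∈? proj₂ u

      -- The parent x can serve as the v-successor of u ∷ x; at-most restrictions force reusing it.
      Covered : Path → HalfType → Set
      Covered [] v = Empty
      Covered (u ∷ x) v = proj₁ v ⊆R proj₁ u ⁻¹ᴿ × (∀ A → A ∈ proj₂ v → Label x A)

      covered? : ∀ x v → Dec (Covered x v)
      covered? [] v = no λ ()
      covered? (u ∷ x) v =
        proj₁ v ⊆R? proj₁ u ⁻¹ᴿ ×-dec Fin.all? (λ A → A ∈? proj₂ v →-dec label? x A)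

      covered-antitone : ∀ x {v w} → v ≼ w → Covered x w → Covered x v
      covered-antitone (u ∷ x) (R⊆ , N⊆) (R⊆u , labels) = ⊆R-trans R⊆ R⊆u , λ A → labels A ∘ N⊆

      Candidate : Path → HalfType → Set
      Candidate x v = Derived (ctx x ⊑∃ proj₁ v ∙ proj₂ v) × ¬ Covered x v

      module Children (x : Path) = Maximal (Candidate x) (λ v → derived? _ ×-dec ¬? (covered? x v))

      Child : Path → HalfType → Set
      Child = Children.Maximal

      -- Bool-valued, so that elements with the same path are equal (T-irrelevant).
      valid : Path → Bool
      valid [] = true
      valid (u ∷ x) = valid x ∧ ⌊ Children.maximal? x u ⌋

      Valid : Path → Set
      Valid = T ∘ valid

      valid-parent : ∀ {u x} → Valid (u ∷ x) → Valid x
      valid-parent {x = x} v = proj₁ (Equivalence.to (T-∧ {valid x}) v)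

      valid-child : ∀ {u x} → Valid (u ∷ x) → Child x u
      valid-child {x = x} v = toWitness (proj₂ (Equivalence.to (T-∧ {valid x}) v))

      valid-∷ : ∀ {u x} → Valid x → Child x u → Valid (u ∷ x)
      valid-∷ {x = x} v c = Equivalence.from (T-∧ {valid x}) (v , fromWitness c)

      child-derived : ∀ {u x} → Child x u → Derived (ctx x ⊑∃ proj₁ u ∙ proj₂ u)
      child-derived c = proj₁ (proj₁ c)

      child-absorbs : ∀ {x u S N} → Child x u →
        Derived (ctx x ⊑∃ S ∙ N) → u ≼ (S , N) → (S , N) ≡ u
      child-absorbs {x} c d u≼ =
        Children.maximal-unique x c (d , proj₂ (proj₁ c) ∘ covered-antitone x u≼) u≼

      consistent-at : ∀ x → Valid x → ¬ Derived (ctx x ⊑ bot)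
      consistent-at [] _ = consistent
      consistent-at (u ∷ x) v p⊥ =
        consistent-at x (valid-parent {u} v) (derived-closed (succ-clash (child-derived (valid-child {u} v)) p⊥))

      label⇒derived : ∀ x {A} → Label x A → Derived (ctx x ⊑ atom A)
      label⇒derived [] l = l
      label⇒derived (u ∷ x) A∈ = derived-closed (present A∈)

      absorbed-concepts : ∀ {x u N} → Child x u →
        Derived (ctx x ⊑∃ proj₁ u ∙ (proj₂ u ∪ N)) → N ⊆ proj₂ u
      absorbed-concepts {u = u} {N} c d A∈N =
        subst (_ ∈_) (cong proj₂ (child-absorbs c d (⊆R-refl , p⊆p∪q N))) (x∈p∪q⁺ (inj₂ A∈N))

      absorbed-roles : ∀ {x u R} → Child x u →
        Derived (ctx x ⊑∃ (proj₁ u ∪ᴿ R) ∙ proj₂ u) → R ⊆R proj₁ u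
      absorbed-roles {u = u} {R} c d r r∈R =
        subst (r ∈R_) (cong proj₁ (child-absorbs c d (R⊆R∪ᴿR' (proj₁ u) R , ⊆-refl)))
          (R'⊆R∪ᴿR' (proj₁ u) R r r∈R)

      derived⇒label : ∀ x {A} → Valid x → Derived (ctx x ⊑ atom A) → Label x A
      derived⇒label [] _ d = d
      derived⇒label (u ∷ x) {A} v d =
        absorbed-concepts c (derived-closed (extend (child-derived c) d refl)) (x∈⁅x⁆ A)
        where c = valid-child {u} v

      Edge : Role → Path → Path → Set
      Edge r x y = (∃ λ u → y ≡ u ∷ x × r ∈R proj₁ u) ⊎ (∃ λ u → x ≡ u ∷ y × r ⁻ ∈R proj₁ u)

      Element : Set
      Element = Σ Path Valid

      element-≡ : ∀ {a b : Element} → proj₁ a ≡ proj₁ b → a ≡ b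
      element-≡ {x , v} {.x , v'} refl = cong (x ,_) (T-irrelevant v v')

      I : Interp
      I = record
        { Δ = Element
        ; elem = [] , tt
        ; conc = λ A a → Label (proj₁ a) A
        ; rname = λ p a b → Edge (name p) (proj₁ a) (proj₁ b)
        }

      roleI⇔Edge : ∀ r {a b} → roleI I r a b ⇔ Edge r (proj₁ a) (proj₁ b)
      roleI⇔Edge (name p) = mk⇔ (λ e → e) (λ e → e)
      roleI⇔Edge (inv p) = mk⇔ swap swap

      bcon⇒derived : ∀ {B} (a : Element) → bconI I B a → Derived (ctx (proj₁ a) ⊑ B)
      bcon⇒derived {atom A} (x , _) l = label⇒derived x l
      bcon⇒derived {top} _ _ = derived-closed (present tt)

      derived⇒bcon : ∀ {B} (a : Element) → Derived (ctx (proj₁ a) ⊑ B) → bconI I B a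
      derived⇒bcon {atom A} (x , v) d = derived⇒label x v d
      derived⇒bcon {top} _ _ = tt
      derived⇒bcon {bot} (x , v) d = consistent-at x v d

      bcon⇒∈ᴮ : ∀ {B u x} (v : Valid (u ∷ x)) → bconI I B (u ∷ x , v) → B ∈ᴮ proj₂ u
      bcon⇒∈ᴮ {atom A} _ A∈ = A∈
      bcon⇒∈ᴮ {top} _ _ = tt

      satisfies-conj : ∀ {A As B} → conjIncl A As B ∈ˡ 𝒯 → satAx I (conjIncl A As B)
      satisfies-conj mem a hA hAs =
        derived⇒bcon a
          (derived-closed (conj mem (bcon⇒derived a hA) (All.map (λ {B} → bcon⇒derived {B} a) hAs)))

      univ-to-child : ∀ {A r B x u} → univIncl A r B ∈ˡ 𝒯 → Valid x → (v : Valid (u ∷ x)) →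
        r ∈R proj₁ u → Derived (ctx x ⊑ A) → bconI I B (u ∷ x , v)
      univ-to-child {B = atom b} {u = u} mem _ v r∈ dA =
        absorbed-concepts c (derived-closed (univ-fwd mem (child-derived c) r∈ dA refl)) (x∈⁅x⁆ b)
        where c = valid-child {u} v
      univ-to-child {B = top} _ _ _ _ _ = tt
      univ-to-child {B = bot} {x = x} {u} mem vx v r∈ dA =
        consistent-at x vx (derived-closed (univ-clash mem (child-derived (valid-child {u} v)) r∈ dA))

      satisfies-univ : ∀ {A r B} → univIncl A r B ∈ˡ 𝒯 → satAx I (univIncl A r B)
      satisfies-univ {r = r} mem (x , vx) (y , vy) hA rxy with Equivalence.to (roleI⇔Edge r) rxy
      ... | inj₁ (u , refl , r∈) = univ-to-child mem vx vy r∈ (bcon⇒derived (x , vx) hA)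
      ... | inj₂ (u , refl , r⁻∈) = derived⇒bcon (y , vy)
        (derived-closed (univ-back mem (child-derived (valid-child {u} vx)) r⁻∈ (bcon⇒derived (x , vx) hA)))

      exists-successor : ∀ {x} r B (v : Valid x) → B ≢ bot →
        Derived (ctx x ⊑∃ ⁅ r ⁆ᴿ ∙ conceptsOf B) →
        Σ Element λ b → roleI I r (x , v) b × bconI I B b
      exists-successor {x} r B v B≢⊥ d with covered? x (⁅ r ⁆ᴿ , conceptsOf B)
      exists-successor {u ∷ z} r B v B≢⊥ d | yes (r⊆ , labels) =
        (z , valid-parent {u} v) ,
        Equivalence.from (roleI⇔Edge r)
          (inj₂ (u , refl , Equivalence.to (∈⁻¹ᴿ⇔∈⁻ r (proj₁ u)) (r⊆ r (r∈⁅r⁆ᴿ r)))) ,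
        conceptsOf-complete I B B≢⊥ labels
      ... | no uncovered with w , child , (r⊆ , N⊆) ← Children.maximal-above x (d , uncovered) =
        (w ∷ x , valid-∷ v child) ,
        Equivalence.from (roleI⇔Edge r) (inj₁ (w , refl , r⊆ r (r∈⁅r⁆ᴿ r))) ,
        conceptsOf-complete I B B≢⊥ (λ A → N⊆)

      satisfies-exist : ∀ {A r B} → existIncl A r B ∈ˡ 𝒯 → satAx I (existIncl A r B)
      satisfies-exist {B = bot} mem (x , v) hA =
        ⊥-elim (consistent-at x v (derived-closed (exist-clash mem (bcon⇒derived (x , v) hA))))
      satisfies-exist {r = r} {atom b} mem (x , v) hA =
        exists-successor r (atom b) v (λ ()) (derived-closed (exist mem (bcon⇒derived (x , v) hA) refl refl))
      satisfies-exist {r = r} {top} mem (x , v) hA =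
        exists-successor r top v (λ ()) (derived-closed (exist mem (bcon⇒derived (x , v) hA) refl refl))

      satisfies-role : ∀ {r s} → roleIncl r s ∈ˡ 𝒯 → satAx I (roleIncl r s)
      satisfies-role {r} {s} mem (x , vx) (y , vy) rxy with Equivalence.to (roleI⇔Edge r) rxy
      ... | inj₁ (u , refl , r∈) = Equivalence.from (roleI⇔Edge s) (inj₁ (u , refl ,
        absorbed-roles c (derived-closed (role-incl mem (child-derived c) r∈ refl)) s (r∈⁅r⁆ᴿ s)))
        where c = valid-child {u} vy
      ... | inj₂ (u , refl , r⁻∈) = Equivalence.from (roleI⇔Edge s) (inj₂ (u , refl ,
        absorbed-roles c (derived-closed (role-incl⁻ mem (child-derived c) r⁻∈ refl))
          (s ⁻) (r∈⁅r⁆ᴿ (s ⁻))))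
        where c = valid-child {u} vx

      no-return : ∀ {A r B z u₂ u₁} → atMostOne A r B ∈ˡ 𝒯 → Valid (u₁ ∷ u₂ ∷ z) →
        ¬ ReturnsVia (A , r , B) (ctx z) (proj₁ u₂) (proj₂ u₂) (proj₁ u₁) (proj₂ u₁)
      no-return {z = z} {u₂} {u₁} mem v ret = proj₂ (proj₁ c₁) (⁻¹ᴿ-adjoint returned-roles , labels)
        where
          v₂ = valid-parent {u₁} {u₂ ∷ z} v
          c₁ = valid-child {u₁} {u₂ ∷ z} v
          c₂ = valid-child {u₂} {z} v₂
          returned-roles = absorbed-roles {z} c₂
            (derived-closed
              (merge-return mem (child-derived {x = z} c₂) (child-derived {x = u₂ ∷ z} c₁) ret refl))
          labels : ∀ A → A ∈ proj₂ u₁ → Label z A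
          labels A A∈ = derived⇒label z (valid-parent {u₂} {z} v₂)
            (derived-closed
              (return mem (child-derived {x = z} c₂) (child-derived {x = u₂ ∷ z} c₁) ret A∈))

      satisfies-atMostOne : ∀ {A r B} → atMostOne A r B ∈ˡ 𝒯 → satAx I (atMostOne A r B)
      satisfies-atMostOne {r = r} mem (x , vx) (y , vy) (z , vz) hA rxy hB rxz hC
        with Equivalence.to (roleI⇔Edge r) rxy | Equivalence.to (roleI⇔Edge r) rxz
      ... | inj₁ (u₁ , refl , r∈₁) | inj₁ (u₂ , refl , r∈₂) =
        element-≡ (cong (_∷ x) (trans (sym (child-absorbs c₁ d (R⊆R∪ᴿR' _ _ , p⊆p∪q _)))
                                      (child-absorbs c₂ d (R'⊆R∪ᴿR' _ _ , q⊆p∪q _ _))))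
        where
          c₁ = valid-child {u₁} vy
          c₂ = valid-child {u₂} vz
          d = derived-closed (merge mem (child-derived c₁) (child-derived c₂) (bcon⇒derived (x , vx) hA)
                r∈₁ r∈₂ (bcon⇒∈ᴮ vy hB) (bcon⇒∈ᴮ vz hC) refl refl)
      ... | inj₁ (u₁ , refl , r∈₁) | inj₂ (u₂ , refl , r⁻∈₂) = ⊥-elim (no-return mem vy
        (r⁻∈₂ , bcon⇒derived (x , vx) hA , bcon⇒derived (z , vz) hC , r∈₁ , bcon⇒∈ᴮ vy hB))
      ... | inj₂ (u₁ , refl , r⁻∈₁) | inj₁ (u₂ , refl , r∈₂) = ⊥-elim (no-return mem vz
        (r⁻∈₁ , bcon⇒derived (x , vx) hA , bcon⇒derived (y , vy) hB , r∈₂ , bcon⇒∈ᴮ vz hC))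
      ... | inj₂ (u₁ , refl , _) | inj₂ (.u₁ , refl , _) = element-≡ refl

      canonical-model : models I 𝒯
      canonical-model = All.tabulate satisfies
        where
          satisfies : ∀ {ax} → ax ∈ˡ 𝒯 → satAx I ax
          satisfies {conjIncl _ _ _} = satisfies-conj
          satisfies {atMostOne _ _ _} = satisfies-atMostOne
          satisfies {univIncl _ _ _} = satisfies-univ
          satisfies {existIncl _ _ _} = satisfies-exist
          satisfies {roleIncl _ _} = satisfies-role

      root : Element
      root = [] , tt

      root-holds : Holds I K₀ root
      root-holds A A∈ = derived-closed (present A∈)

      reachable-derived : ∀ {N} b → Holds I N b → Derived (K₀ ⊑◇ N)
      reachable-derived (x , v) hb = climb x v (derived-closed (reach-here (λ A → label⇒derived x ∘ hb A)))
        where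
          climb : ∀ {N} x → Valid x → Derived (ctx x ⊑◇ N) → Derived (K₀ ⊑◇ N)
          climb [] _ d = d
          climb (u ∷ x) v d =
            climb x (valid-parent {u} v) (derived-closed (reach-succ (child-derived {x = x} (valid-child {u} v)) d))

      root-successor-derived : ∀ {R N} b → Linked I R root b → Holds I N b → (∃ λ r → r ∈R R) →
        ∃ λ u → Derived (K₀ ⊑∃ proj₁ u ∙ proj₂ u) × R ⊆R proj₁ u × N ⊆ proj₂ u
      root-successor-derived (y , vy) l hb (r , r∈R) with Equivalence.to (roleI⇔Edge r) (l r r∈R)
      ... | inj₁ (u , refl , _) = u , child-derived {x = []} (valid-child {u} vy) , edge-role , λ {A} → hb A
        where
          edge-role : ∀ r' → r' ∈R _ → r' ∈R proj₁ u
          edge-role r' r'∈R with Equivalence.to (roleI⇔Edge r') (l r' r'∈R)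
          ... | inj₁ (_ , refl , r'∈) = r'∈

    entails? : ∀ K R N → Dec (Entails∃ 𝒯 K R N)
    entails? K R N with derived? (K ⊑ bot) | ∃? roles (λ r → r ∈R? R)
    ... | yes p⊥ | _ = yes λ I m e h → ⊥-elim (derived-sound p⊥ I m e h)
    ... | no consistent | no no-role = decide-via (derived? (K ⊑◇ N))
      (entails∃-mono ⊆-refl (λ r r∈R → ⊥-elim (no-role (r , r∈R))) ⊆-refl ∘ derived-sound)
      (λ ent → let b , _ , hb = ent I canonical-model root root-holds in reachable-derived b hb)
      where open CanonicalModel K consistent
    ... | no consistent | yes some-role = decide-via
      (∃? halfTypes λ u → derived? (K ⊑∃ proj₁ u ∙ proj₂ u) ×-dec R ⊆R? proj₁ u ×-dec N ⊆? proj₂ u)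
      (λ (u , d , R⊆ , N⊆) → entails∃-mono ⊆-refl R⊆ N⊆ (derived-sound d))
      (λ ent → let b , l , hb = ent I canonical-model root root-holds
               in root-successor-derived b l hb some-role)
      where open CanonicalModel K consistent

  module GoodSuccessors (𝒯 : TBox) (F : List TwoType) where
    open Calculus 𝒯 using (entails?)

    Unrealised : HalfType → Set
    Unrealised u = ∀ t → t ∈ˡ F → ¬ (proj₁ u ⊆R π₂ t) ⊎ ¬ (proj₂ u ⊆ π₃ t)

    Required : HalfType → Set₁
    Required u = (∃ λ t → t ∈ˡ F × Entails∃ 𝒯 (π₁ t) (proj₁ u) (proj₂ u)) × Unrealised u

    required? : ∀ u → Dec (Required u)
    required? u = decide-via
      (any? (λ t → entails? (π₁ t) (proj₁ u) (proj₂ u)) F ×-dec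
       all? (λ t → ¬? (proj₁ u ⊆R? π₂ t) ⊎-dec ¬? (proj₂ u ⊆? π₃ t)) F)
      (λ (a , unrealised) → let t , t∈ , ent = find a in (t , t∈ , ent) , λ t → lookupᴬ unrealised)
      (λ ((t , t∈ , ent) , unrealised) → lose t∈ ent , All.tabulate λ {t} → unrealised t)

    open Maximal Required required?

    succ : List HalfType
    succ = filter maximal? (proj₁ halfTypes)

    ∈succ⇔maximal : ∀ {u} → u ∈ˡ succ ⇔ Maximal u
    ∈succ⇔maximal {u} =
      mk⇔ (proj₂ ∘ ∈-filter⁻ maximal? {xs = proj₁ halfTypes}) (∈-filter⁺ maximal? (proj₂ halfTypes u))

    succ-good : GoodSucc 𝒯 F succ
    succ-good = r1 , r2 , r3 , r4
      where
        r1 : R1 𝒯 F succ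
        r1 M R N (t , t∈ , M⊆) ent unrealised
          with w , max , R⊆ , N⊆ ←
                 maximal-above ((t , t∈ , entails∃-mono M⊆ ⊆R-refl ⊆-refl ent) , unrealised)
          = w , Equivalence.from ∈succ⇔maximal max , R⊆ , N⊆
        r2 : R2 𝒯 F succ
        r2 u u∈ =
          let (t , t∈ , ent) , _ = proj₁ (Equivalence.to ∈succ⇔maximal u∈) in t , π₁ t , t∈ , ⊆-refl , ent
        r3 : R3 succ
        r3 u u' u∈ u'∈ u≢u' u≼u' =
          u≢u' (sym (maximal-unique (Equivalence.to ∈succ⇔maximal u∈)
                                    (proj₁ (Equivalence.to ∈succ⇔maximal u'∈)) u≼u'))
        r4 : R4 F succ
        r4 u t u∈ t∈ = proj₂ (proj₁ (Equivalence.to ∈succ⇔maximal u∈)) t t∈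

    required-of-good : ∀ {S} → GoodSucc 𝒯 F S → ∀ {u} → u ∈ˡ S → Required u
    required-of-good (_ , r2 , _ , r4) {u} u∈ =
      let t , M , t∈ , M⊆ , ent = r2 u u∈
      in (t , t∈ , entails∃-mono M⊆ ⊆R-refl ⊆-refl ent) , λ t t∈ → r4 u t u∈ t∈

    maximal⇒∈good : ∀ {S} → GoodSucc 𝒯 F S → ∀ {u} → Maximal u → u ∈ˡ S
    maximal⇒∈good {S} good@(r1 , _) {u} max@(((t , t∈ , ent) , unrealised) , _)
      with u' , u'∈ , R⊆ , N⊆ ← r1 (π₁ t) (proj₁ u) (proj₂ u) (t , t∈ , ⊆-refl) ent unrealised
      = subst (_∈ˡ S) (maximal-unique max (required-of-good good u'∈) (R⊆ , N⊆)) u'∈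

    good⇒maximal : ∀ {S} → GoodSucc 𝒯 F S → ∀ {u} → u ∈ˡ S → Maximal u
    good⇒maximal good@(_ , _ , r3 , _) {u} u∈
      with w , max , u≼w ← maximal-above (required-of-good good u∈)
      with u ≟ʰ w
    ... | yes refl = max
    ... | no u≢w = ⊥-elim (r3 u w u∈ (maximal⇒∈good good max) u≢w u≼w)

    succ-unique : ∀ {S} → GoodSucc 𝒯 F S → ∀ u → u ∈ˡ succ ⇔ u ∈ˡ S
    succ-unique good u = mk⇔ (maximal⇒∈good good ∘ Equivalence.to ∈succ⇔maximal)
                             (Equivalence.from ∈succ⇔maximal ∘ good⇒maximal good)

open Sig

mainTheorem1 : (nC nR : ℕ) (T : TBox {nC} {nR}) (F : List (TwoType {nC} {nR})) →
    (∀ t t' → t ∈ˡ F → t' ∈ˡ F → π₁ t ≡ π₁ t') →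
    Σ (List (HalfType {nC} {nR})) λ S → GoodSucc T F S ×
      (∀ S' → GoodSucc T F S' → ∀ u → (u ∈ˡ S) ⇔ (u ∈ˡ S'))
mainTheorem1 nC nR T F _ = succ , succ-good , λ S' good → succ-unique good
  where open GoodSuccessors T F
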